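{- Let $\mu$ be a nonempty partition. Then \[ \mu^r_i=\begin{cases}\mu_i+1 & \text{if } i<d(\mu),\\ \mu_{i+1} & \text{if } i\ge d(\mu).\end{cases} \] That is, $\mu^r$ is obtained from $\mu$ by removing the part $\mu_{d(\mu)}$ and adding $1$ to each part $\mu_j$ with $j<d(\mu)$.
   Context: For a partition $\lambda$ set $\lambda_t=0$ for $t>\ell(\lambda)$; $d(\lambda)$ is the largest $i\ge1$ with $\lambda_i\ge i$ (length of the diagonal). The Maya diagram of $\lambda$ is $S(\lambda)=\{\lambda_t-t+\tfrac12: t\ge1\}\subseteq\mathbb{Z}+\tfrac12$. For $S\subseteq\mathbb{Z}+\tfrac12$ let $S^+=\{x\in S:x>0\}$ and $S^-=\{x\in(\mathbb{Z}+\tfrac12)\setminus S: x<0\}$; if both are finite, the charge is $c(S)=|S^+|-|S^-|$ and $\{s-c(S):s\in S\}$ is the Maya diagram of a unique partition, called the partition associated to $S$. For a nonempty partition $\mu$ with $S=S(\mu)$, $\mu^r$ is the partition associated to $S\setminus\{\min S^+\}$ (charge $-1$). -}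

module Defs where

open import Data.Nat using (ℕ; zero; suc; _≤_; _<_; _≥_)
open import Data.Integer as ℤ using (ℤ; +_; _-_; _+_)
open import Data.List using (List; []; _∷_; length)
open import Data.List.Relation.Unary.All using (All)
open import Data.List.Relation.Unary.Linked using (Linked)
open import Data.List.Relation.Unary.Unique.Propositional using (Unique)
open import Data.List.Membership.Propositional using (_∈_)
open import Data.Product using (Σ; _×_; ∃)
open import Relation.Nullary using (¬_)
open import Relation.Binary.PropositionalEquality using (_≡_; _≢_)
open import Function.Bundles using (_⇔_)

record Partition : Set where
  constructor mkPartition
  field
    parts    : List ℕ
    positive : All (1 ≤_) parts
    decr     : Linked _≥_ parts
open Partition public

nth : List ℕ → ℕ → ℕ
nth []       _       = 0
nth (x ∷ _)  zero    = x
nth (_ ∷ xs) (suc n) = nth xs n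

-- λ_t (1-indexed), with λ_t = 0 for t > ℓ(λ) (and, harmlessly, λ_0 := λ_1 is never used)
_‼_ : Partition → ℕ → ℕ
λ' ‼ zero  = nth (parts λ') zero
λ' ‼ suc t = nth (parts λ') t

Nonempty : Partition → Set
Nonempty λ' = 1 ≤ length (parts λ')

IsDiag : Partition → ℕ → Set
IsDiag λ' d = (1 ≤ d) × (d ≤ λ' ‼ d) × (∀ i → 1 ≤ i → i ≤ λ' ‼ i → i ≤ d)

-- Subsets of ℤ + 1/2, encoded: the integer k stands for the half-integer k + 1/2.
-- Thus k + 1/2 > 0 iff k ≥ 0, and k + 1/2 < 0 iff k < 0.
HSet : Set₁
HSet = ℤ → Set

Maya : Partition → HSet
Maya λ' k = Σ ℕ λ t → (1 ≤ t) × ((+ (λ' ‼ t)) - (+ t) ≡ k)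

_≈ₛ_ : HSet → HSet → Set
S ≈ₛ T = ∀ k → S k ⇔ T k

-- c is the charge of S: S⁺ and S⁻ are finite (enumerated without repetition
-- by the lists L⁺, L⁻) and c = |S⁺| - |S⁻|.
IsCharge : HSet → ℤ → Set
IsCharge S c =
  Σ (List ℤ) λ L⁺ → Σ (List ℤ) λ L⁻ →
    Unique L⁺ × Unique L⁻ ×
    (∀ k → (k ∈ L⁺) ⇔ (S k × (+ 0) ℤ.≤ k)) ×
    (∀ k → (k ∈ L⁻) ⇔ ((¬ S k) × k ℤ.< (+ 0))) ×
    (c ≡ (+ length L⁺) - (+ length L⁻))

shift : HSet → ℤ → HSet
shift S c k = S (k + c)

AssociatedTo : Partition → HSet → Set
AssociatedTo ν S = Σ ℤ λ c → IsCharge S c × (Maya ν ≈ₛ shift S c)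

IsMinPos : HSet → ℤ → Set
IsMinPos S m = S m × ((+ 0) ℤ.≤ m) × (∀ k → S k → (+ 0) ℤ.≤ k → m ℤ.≤ k)

remove : HSet → ℤ → HSet
remove S m k = S k × k ≢ m

IsMuR : Partition → Partition → Set
IsMuR μ ν = Σ ℤ λ m → IsMinPos (Maya μ) m × AssociatedTo ν (remove (Maya μ) m)

module Submission where

-- Index S(μ) by the strictly decreasing sequence a j = μ_{j+1} - (j+1), so a j ≥ 0 exactly for
-- j < d and min S(μ)⁺ = a (d-1). Removing it leaves a 0 > … > a (d-2) > a d > a (d+1) > …, which is
-- the Maya diagram, shifted by -1, of the list obtained from μ by dropping μ_d and adding 1 to the
-- earlier parts; counting the positive points and the negative holes gives charge -1. Conversely,
-- if S(ν) + c is the same set, the two decreasing enumerations coincide, and far out (where both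
-- are j ↦ -(j+1)) this forces c = -1 and hence ν = μʳ.

open import Defs
open import Data.Nat using (ℕ; suc; _+_; _≤_; _<_)
open import Data.Product using (Σ; _×_)
open import Relation.Binary.PropositionalEquality using (_≡_)

open import Data.Empty using (⊥-elim)
open import Data.Sum using (inj₁; inj₂)
open import Data.Integer as ℤ using (ℤ; +_; -[1+_]; _-_; _⊖_)
  renaming (_+_ to _+ℤ_; _≤_ to _≤ℤ_; _<_ to _<ℤ_)
import Data.Integer.Properties as ℤP
open import Algebra.Bundles using (AbelianGroup)
open import Algebra.Properties.Group (AbelianGroup.group ℤP.+-0-abelianGroup)
  using (∙-cancelˡ; ∙-cancelʳ)
open import Data.Integer.Tactic.RingSolver using (solve-∀)
open import Data.List using (List; []; _∷_; length; filter; applyUpTo)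
open import Data.List.Membership.Propositional using (_∈_)
open import Data.List.Membership.Propositional.Properties using (∈-filter⁺; ∈-filter⁻)
open import Data.List.Membership.Propositional.Properties.WithK using (unique∧set⇒bag)
open import Data.List.Properties using (length-applyUpTo)
open import Data.List.Relation.Binary.BagAndSetEquality using (∼bag⇒↭)
open import Data.List.Relation.Binary.Permutation.Propositional.Properties using (↭-length)
open import Data.List.Relation.Unary.All using (All; []; _∷_)
open import Data.List.Relation.Unary.Any.Properties using (applyUpTo⁺; applyUpTo⁻)
open import Data.List.Relation.Unary.Linked using (Linked; []; [-]; _∷_)
open import Data.List.Relation.Unary.Unique.Propositional using (Unique)
import Data.List.Relation.Unary.Unique.Propositional.Properties as Unique
open import Data.Nat using (zero; z≤n; s≤s; _∸_; _≥_; _≤′_; ≤′-refl; ≤′-step)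
open import Data.Nat.Induction using (<-rec)
import Data.Nat.Properties as ℕP
open import Data.Product using (∃; _,_; proj₁; proj₂)
open import Function using (_∘_)
open import Function.Bundles using (_⇔_; mk⇔; Equivalence)
open import Relation.Binary.Definitions using (DecidableEquality; tri<; tri≈; tri>)
open import Relation.Binary.PropositionalEquality using (_≢_; _≗_; refl; sym; trans; cong; subst)
open import Relation.Nullary using (¬_; ¬?; yes; no)
open import Relation.Unary using (Decidable)

open Equivalence using (to; from)

module _ {A : Set} {P : A → Set} (P? : Decidable P) where

  length-filter+length-filter-∁ : ∀ xs →
    length (filter P? xs) + length (filter (¬? ∘ P?) xs) ≡ length xs
  length-filter+length-filter-∁ [] = refl
  length-filter+length-filter-∁ (x ∷ xs) with P? x
  ... | yes _ = cong suc (length-filter+length-filter-∁ xs)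
  ... | no  _ = trans (ℕP.+-suc _ _) (cong suc (length-filter+length-filter-∁ xs))

module _ {A : Set} (_≟_ : DecidableEquality A) where

  open import Data.List.Membership.DecPropositional _≟_ using (_∈?_)

  length-filter-∉ : ∀ {xs ys : List A} → Unique xs → Unique ys → (∀ {x} → x ∈ ys → x ∈ xs) →
    length (filter (λ x → ¬? (x ∈? ys)) xs) + length ys ≡ length xs
  length-filter-∉ {xs} {ys} xs! ys! ys⊆xs = begin
    length outside + length ys     ≡⟨ cong (λ n → length outside + n) (sym |inside|≡|ys|) ⟩
    length outside + length inside ≡⟨ ℕP.+-comm (length outside) (length inside) ⟩
    length inside + length outside ≡⟨ length-filter+length-filter-∁ (_∈? ys) xs ⟩
    length xs                      ∎
    where
    open Relation.Binary.PropositionalEquality.≡-Reasoning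
    inside outside : List A
    inside  = filter (_∈? ys) xs
    outside = filter (¬? ∘ (_∈? ys)) xs
    inside⇔ys : ∀ {x} → x ∈ inside ⇔ x ∈ ys
    inside⇔ys = mk⇔ (proj₂ ∘ ∈-filter⁻ (_∈? ys) {xs = xs}) (λ x∈ys → ∈-filter⁺ (_∈? ys) (ys⊆xs x∈ys) x∈ys)
    |inside|≡|ys| : length inside ≡ length ys
    |inside|≡|ys| = ↭-length (∼bag⇒↭ (unique∧set⇒bag (Unique.filter⁺ (_∈? ys) xs!) ys! inside⇔ys))

-- Strictly decreasing integer sequences

StrictlyDecreasing : (ℕ → ℤ) → Set
StrictlyDecreasing f = ∀ j → f (suc j) <ℤ f j

Enumerates : HSet → (ℕ → ℤ) → Set
Enumerates T f = (∀ j → T (f j)) × (∀ {k} → T k → ∃ λ j → f j ≡ k)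

module _ {f : ℕ → ℤ} (f↓ : StrictlyDecreasing f) where

  decreasing-< : ∀ {i j} → i < j → f j <ℤ f i
  decreasing-< = go ∘ ℕP.≤⇒≤′
    where
    go : ∀ {i j} → suc i ≤′ j → f j <ℤ f i
    go ≤′-refl       = f↓ _
    go (≤′-step i<j) = ℤP.<-trans (f↓ _) (go i<j)

  decreasing-≤ : ∀ {i j} → i ≤ j → f j ≤ℤ f i
  decreasing-≤ i≤j with ℕP.m≤n⇒m<n∨m≡n i≤j
  ... | inj₁ i<j  = ℤP.<⇒≤ (decreasing-< i<j)
  ... | inj₂ refl = ℤP.≤-refl

  decreasing-injective : ∀ {i j} → f i ≡ f j → i ≡ j
  decreasing-injective {i} {j} fi≡fj with ℕP.<-cmp i j
  ... | tri< i<j _ _ = ⊥-elim (ℤP.<-irrefl (sym fi≡fj) (decreasing-< i<j))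
  ... | tri≈ _ i≡j _ = i≡j
  ... | tri> _ _ j<i = ⊥-elim (ℤP.<-irrefl fi≡fj (decreasing-< j<i))

-- j < n is impossible, since then f j = g j = f n.
private
  agreeing-below⇒≤ : ∀ {f g} → StrictlyDecreasing f → StrictlyDecreasing g → ∀ {n} →
    (∀ {i} → i < n → f i ≡ g i) → ∃ (λ j → g j ≡ f n) → f n ≤ℤ g n
  agreeing-below⇒≤ {f} {g} f↓ g↓ {n} f≡g (j , gj≡fn) with j ℕP.<? n
  ... | yes j<n = ⊥-elim (ℕP.<-irrefl (decreasing-injective f↓ (trans (f≡g j<n) gj≡fn)) j<n)
  ... | no  j≮n = subst (_≤ℤ g n) gj≡fn (decreasing-≤ g↓ (ℕP.≮⇒≥ j≮n))

decreasing-enumeration-unique : ∀ {T f g} → StrictlyDecreasing f → StrictlyDecreasing g →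
  Enumerates T f → Enumerates T g → f ≗ g
decreasing-enumeration-unique {f = f} {g} f↓ g↓ (f∈T , T⊆f) (g∈T , T⊆g) =
  <-rec (λ n → f n ≡ g n) step
  where
  step : ∀ n → (∀ {i} → i < n → f i ≡ g i) → f n ≡ g n
  step n f≡g = ℤP.≤-antisym
    (agreeing-below⇒≤ f↓ g↓ f≡g (T⊆g (f∈T n)))
    (agreeing-below⇒≤ g↓ f↓ (sym ∘ f≡g) (T⊆f (g∈T n)))

nth-suc≤nth : ∀ {xs} → Linked _≥_ xs → ∀ j → nth xs (suc j) ≤ nth xs j
nth-suc≤nth []        _       = z≤n
nth-suc≤nth [-]       _       = z≤n
nth-suc≤nth (x≥y ∷ _) zero    = x≥y
nth-suc≤nth (_ ∷ l)   (suc j) = nth-suc≤nth l j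

nth-antitone : ∀ {xs} → Linked _≥_ xs → ∀ {i j} → i ≤ j → nth xs j ≤ nth xs i
nth-antitone {xs} l = go ∘ ℕP.≤⇒≤′
  where
  go : ∀ {i j} → i ≤′ j → nth xs j ≤ nth xs i
  go ≤′-refl       = ℕP.≤-refl
  go (≤′-step i≤j) = ℕP.≤-trans (nth-suc≤nth l _) (go i≤j)

nth-beyond : ∀ xs {j} → length xs ≤ j → nth xs j ≡ 0
nth-beyond []       _                = refl
nth-beyond (_ ∷ xs) (s≤s |xs|≤j) = nth-beyond xs |xs|≤j

-- For xs = parts μ, position xs j encodes the point μ_{j+1} - (j+1) + 1/2 of S(μ).

position : List ℕ → ℕ → ℤ
position xs j = + nth xs j - + suc j

position-decreasing : ∀ {xs} → Linked _≥_ xs → StrictlyDecreasing (position xs)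
position-decreasing l j =
  ℤP.+-mono-≤-< (ℤ.+≤+ (nth-suc≤nth l j)) (ℤP.neg-mono-< (ℤ.+<+ (ℕP.n<1+n (suc j))))

0≤position⇔ : ∀ xs j → + 0 ≤ℤ position xs j ⇔ suc j ≤ nth xs j
0≤position⇔ xs j = mk⇔ (ℤP.drop‿+≤+ ∘ ℤP.0≤i-j⇒j≤i) (ℤP.i≤j⇒0≤j-i ∘ ℤ.+≤+)

position-beyond : ∀ xs {j} → length xs ≤ j → position xs j ≡ -[1+ j ]
position-beyond xs {j} |xs|≤j = cong (λ m → + m - + suc j) (nth-beyond xs |xs|≤j)

position-negative : ∀ xs {j} → position xs j <ℤ + 0 → position xs j ≡ -[1+ j ∸ nth xs j ]
position-negative xs {j} neg = begin
  + m - + suc j        ≡⟨ ℤP.[+m]-[+n]≡m⊖n m (suc j) ⟩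
  m ⊖ suc j            ≡⟨ ℤP.⊖-≤ (ℕP.m≤n⇒m≤1+n m≤j) ⟩
  ℤ.- + (suc j ∸ m)    ≡⟨ cong (ℤ.-_ ∘ +_) (ℕP.+-∸-assoc 1 m≤j) ⟩
  -[1+ j ∸ m ]         ∎
  where
  open Relation.Binary.PropositionalEquality.≡-Reasoning
  m : ℕ
  m = nth xs j
  m≤j : m ≤ j
  m≤j = ℕP.≤-pred (ℕP.≰⇒> (ℤP.<⇒≱ neg ∘ from (0≤position⇔ xs j)))

dropAndBump : ℕ → List ℕ → List ℕ
dropAndBump _       []       = []
dropAndBump zero    (_ ∷ xs) = xs
dropAndBump (suc e) (x ∷ xs) = suc x ∷ dropAndBump e xs

nth-dropAndBump-< : ∀ e xs {j} → e < length xs → j < e → nth (dropAndBump e xs) j ≡ suc (nth xs j)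
nth-dropAndBump-< (suc e) (x ∷ xs) {zero}  _            _         = refl
nth-dropAndBump-< (suc e) (x ∷ xs) {suc j} (s≤s e<|xs|) (s≤s j<e) = nth-dropAndBump-< e xs e<|xs| j<e

nth-dropAndBump-≥ : ∀ e xs {j} → e ≤ j → nth (dropAndBump e xs) j ≡ nth xs (suc j)
nth-dropAndBump-≥ e       []       _         = refl
nth-dropAndBump-≥ zero    (x ∷ xs) _         = refl
nth-dropAndBump-≥ (suc e) (x ∷ xs) (s≤s e≤j) = nth-dropAndBump-≥ e xs e≤j

dropAndBump-positive : ∀ e {xs} → All (1 ≤_) xs → All (1 ≤_) (dropAndBump e xs)
dropAndBump-positive _       []       = []
dropAndBump-positive zero    (_ ∷ ps) = ps
dropAndBump-positive (suc e) (_ ∷ ps) = s≤s z≤n ∷ dropAndBump-positive e ps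

dropAndBump-decreasing : ∀ e {xs} → Linked _≥_ xs → Linked _≥_ (dropAndBump e xs)
dropAndBump-decreasing _             []              = []
dropAndBump-decreasing zero          [-]             = []
dropAndBump-decreasing zero          (_ ∷ l)         = l
dropAndBump-decreasing (suc e)       [-]             = [-]
dropAndBump-decreasing (suc zero)    (_ ∷ [-])       = [-]
dropAndBump-decreasing (suc zero)    (x≥y ∷ y≥z ∷ l) = ℕP.m≤n⇒m≤1+n (ℕP.≤-trans y≥z x≥y) ∷ l
dropAndBump-decreasing (suc (suc e)) (x≥y ∷ l)       = s≤s x≥y ∷ dropAndBump-decreasing (suc e) l

position-dropAndBump-< : ∀ e xs {j} → e < length xs → j < e →
  position (dropAndBump e xs) j +ℤ -[1+ 0 ] ≡ position xs j
position-dropAndBump-< e xs {j} e<|xs| j<e =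
  trans (cong (λ m → (+ m - + suc j) +ℤ -[1+ 0 ]) (nth-dropAndBump-< e xs e<|xs| j<e))
        (unbump (+ nth xs j) (+ suc j))
  where
  unbump : ∀ x y → ((+ 1 +ℤ x) - y) +ℤ ℤ.- + 1 ≡ x - y
  unbump = solve-∀

position-dropAndBump-≥ : ∀ e xs {j} → e ≤ j →
  position (dropAndBump e xs) j +ℤ -[1+ 0 ] ≡ position xs (suc j)
position-dropAndBump-≥ e xs {j} e≤j =
  trans (cong (λ m → (+ m - + suc j) +ℤ -[1+ 0 ]) (nth-dropAndBump-≥ e xs e≤j))
        (shift-index (+ nth xs (suc j)) (+ suc j))
  where
  shift-index : ∀ x y → (x - y) +ℤ ℤ.- + 1 ≡ x - (+ 1 +ℤ y)
  shift-index = solve-∀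

-- Maya diagrams

Maya-position : ∀ κ j → Maya κ (position (parts κ) j)
Maya-position κ j = suc j , s≤s z≤n , refl

Maya⇒position : ∀ κ {k} → Maya κ k → ∃ λ j → position (parts κ) j ≡ k
Maya⇒position κ (suc j , _ , pj≡k) = j , pj≡k

Maya≈shift⇔enumerates : ∀ κ T c →
  Maya κ ≈ₛ shift T c ⇔ Enumerates T (λ j → position (parts κ) j +ℤ c)
Maya≈shift⇔enumerates κ T c = mk⇔ enumerates Maya≈shift
  where
  subtract-add : ∀ k c → (k - c) +ℤ c ≡ k
  subtract-add = solve-∀

  enumerates : Maya κ ≈ₛ shift T c → Enumerates T (λ j → position (parts κ) j +ℤ c)
  enumerates Maya≈ = (λ j → to (Maya≈ _) (Maya-position κ j)) , covers
    where
    covers : ∀ {k} → T k → ∃ λ j → position (parts κ) j +ℤ c ≡ k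
    covers {k} Tk with Maya⇒position κ (from (Maya≈ (k - c)) (subst T (sym (subtract-add k c)) Tk))
    ... | j , pj≡k-c = j , trans (cong (_+ℤ c) pj≡k-c) (subtract-add k c)

  Maya≈shift : Enumerates T (λ j → position (parts κ) j +ℤ c) → Maya κ ≈ₛ shift T c
  Maya≈shift (in-T , covers) k = mk⇔ into onto
    where
    into : Maya κ k → T (k +ℤ c)
    into Mk with Maya⇒position κ Mk
    ... | j , refl = in-T j
    onto : T (k +ℤ c) → Maya κ k
    onto Tk+c with covers Tk+c
    ... | j , pj+c≡k+c = suc j , s≤s z≤n , ∙-cancelʳ c _ _ pj+c≡k+c

-- Far out both Maya diagrams consist of all sufficiently negative points, which pins down
-- the shift; a strictly decreasing enumeration of a set is then unique.
Maya≈shift-injective : ∀ ν ν′ {T c c′} → Maya ν ≈ₛ shift T c → Maya ν′ ≈ₛ shift T c′ →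
  ∀ j → nth (parts ν) j ≡ nth (parts ν′) j
Maya≈shift-injective ν ν′ {T} {c} {c′} Maya-ν Maya-ν′ j =
  ℤP.+-injective (∙-cancelʳ (ℤ.- + suc j) _ _ position≡)
  where
  enum≗ : (λ i → position (parts ν) i +ℤ c) ≗ (λ i → position (parts ν′) i +ℤ c′)
  enum≗ = decreasing-enumeration-unique
    (λ i → ℤP.+-monoˡ-< c  (position-decreasing (decr ν) i))
    (λ i → ℤP.+-monoˡ-< c′ (position-decreasing (decr ν′) i))
    (to (Maya≈shift⇔enumerates ν T c) Maya-ν) (to (Maya≈shift⇔enumerates ν′ T c′) Maya-ν′)
  far : ℕ
  far = length (parts ν) + length (parts ν′)
  c≡c′ : c ≡ c′
  c≡c′ = ∙-cancelˡ -[1+ far ] c c′ (begin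
    -[1+ far ] +ℤ c                    ≡⟨ cong (_+ℤ c) (sym (position-beyond (parts ν) (ℕP.m≤m+n _ _))) ⟩
    position (parts ν) far +ℤ c        ≡⟨ enum≗ far ⟩
    position (parts ν′) far +ℤ c′      ≡⟨ cong (_+ℤ c′) (position-beyond (parts ν′) (ℕP.m≤n+m _ _)) ⟩
    -[1+ far ] +ℤ c′                   ∎)
    where open Relation.Binary.PropositionalEquality.≡-Reasoning
  position≡ : position (parts ν) j ≡ position (parts ν′) j
  position≡ = ∙-cancelʳ c _ _ (trans (enum≗ j) (cong (position (parts ν′) j +ℤ_) (sym c≡c′)))

IsMinPos-unique : ∀ {S m m′} → IsMinPos S m → IsMinPos S m′ → m ≡ m′
IsMinPos-unique (Sm , 0≤m , m-min) (Sm′ , 0≤m′ , m′-min) =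
  ℤP.≤-antisym (m-min _ Sm′ 0≤m′) (m′-min _ Sm 0≤m)

-- The partition μʳ

module Diagonal (μ : Partition) (e : ℕ) (diag : IsDiag μ (suc e)) where

  open import Data.List.Membership.DecPropositional ℤ._≟_ using (_∈?_)

  private
    P : List ℕ
    P = parts μ
    n : ℕ
    n = length P
    a : ℕ → ℤ
    a = position P
    a↓ : StrictlyDecreasing a
    a↓ = position-decreasing (decr μ)
    d≤μd : suc e ≤ nth P e
    d≤μd = proj₁ (proj₂ diag)
    d-max : ∀ i → 1 ≤ i → i ≤ μ ‼ i → i ≤ suc e
    d-max = proj₂ (proj₂ diag)

  S : HSet
  S = Maya μ

  e<length : e < n
  e<length = ℕP.≰⇒> (λ n≤e → ℕP.n≮0 (subst (suc e ≤_) (nth-beyond P n≤e) d≤μd))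

  0≤a⇔ : ∀ j → + 0 ≤ℤ a j ⇔ j ≤ e
  0≤a⇔ j = mk⇔
    (λ 0≤aj → ℕP.≤-pred (d-max (suc j) (s≤s z≤n) (to (0≤position⇔ P j) 0≤aj)))
    (λ j≤e → from (0≤position⇔ P j) (ℕP.≤-trans (s≤s j≤e) (ℕP.≤-trans d≤μd (nth-antitone (decr μ) j≤e))))

  a<0 : ∀ {j} → e < j → a j <ℤ + 0
  a<0 {j} e<j = ℤP.≰⇒> (ℕP.<⇒≱ e<j ∘ to (0≤a⇔ j))

  min-S⁺ : IsMinPos S (a e)
  min-S⁺ = Maya-position μ e , from (0≤a⇔ e) ℕP.≤-refl , a-min
    where
    a-min : ∀ k → S k → + 0 ≤ℤ k → a e ≤ℤ k
    a-min k Sk 0≤k with Maya⇒position μ Sk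
    ... | j , refl = decreasing-≤ a↓ (to (0≤a⇔ j) 0≤k)

  S′ : HSet
  S′ = remove S (a e)

  S⇒S′ : ∀ {k} → k <ℤ + 0 → S k → S′ k
  S⇒S′ k<0 Sk = Sk , λ { refl → ℤP.<⇒≱ k<0 (from (0≤a⇔ e) ℕP.≤-refl) }

  μʳ : Partition
  μʳ = mkPartition (dropAndBump e P) (dropAndBump-positive e (positive μ)) (dropAndBump-decreasing e (decr μ))

  μʳ-enumerates : Enumerates S′ (λ j → position (parts μʳ) j +ℤ -[1+ 0 ])
  μʳ-enumerates = in-S′ , covers
    where
    in-S′ : ∀ j → S′ (position (parts μʳ) j +ℤ -[1+ 0 ])
    in-S′ j with j ℕP.<? e
    ... | yes j<e = subst S′ (sym (position-dropAndBump-< e P e<length j<e))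
                      (Maya-position μ j , ℕP.<⇒≢ j<e ∘ decreasing-injective a↓)
    ... | no  j≮e = subst S′ (sym (position-dropAndBump-≥ e P (ℕP.≮⇒≥ j≮e)))
                      (Maya-position μ (suc j) , ℕP.>⇒≢ (s≤s (ℕP.≮⇒≥ j≮e)) ∘ decreasing-injective a↓)
    preimage : ∀ t → t ≢ e → ∃ λ j → position (parts μʳ) j +ℤ -[1+ 0 ] ≡ a t
    preimage t       t≢e with ℕP.<-cmp t e
    preimage t       t≢e | tri< t<e _ _       = t , position-dropAndBump-< e P e<length t<e
    preimage t       t≢e | tri≈ _ t≡e _       = ⊥-elim (t≢e t≡e)
    preimage (suc j) t≢e | tri> _ _ (s≤s e≤j) = j , position-dropAndBump-≥ e P e≤j
    covers : ∀ {k} → S′ k → ∃ λ j → position (parts μʳ) j +ℤ -[1+ 0 ] ≡ k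
    covers (Sk , k≢ae) with Maya⇒position μ Sk
    ... | t , refl = preimage t (k≢ae ∘ cong a)

  -- S′⁺ is {a j : j < e}. Every negative point of S below -n is some a t with t ≥ n, so S′⁻ is
  -- what remains of {-1, …, -n} after deleting the n - (e+1) points a t with e < t < n.
  private
    L⁺ negatives inner-negatives L⁻ : List ℤ
    L⁺              = applyUpTo a e
    negatives       = applyUpTo -[1+_] n
    inner-negatives = applyUpTo (λ i → a (suc e + i)) (n ∸ suc e)
    L⁻              = filter (λ k → ¬? (k ∈? inner-negatives)) negatives

    negatives! : Unique negatives
    negatives! = Unique.applyUpTo⁺₁ -[1+_] n (λ i<j _ → ℕP.<⇒≢ i<j ∘ ℤP.-[1+-injective)

    inner-negatives! : Unique inner-negatives
    inner-negatives! = Unique.applyUpTo⁺₁ _ (n ∸ suc e)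
      (λ i<j _ → ℕP.<⇒≢ i<j ∘ ℕP.+-cancelˡ-≡ (suc e) _ _ ∘ decreasing-injective a↓)

    ∈negatives⇒<0 : ∀ {k} → k ∈ negatives → k <ℤ + 0
    ∈negatives⇒<0 k∈ with applyUpTo⁻ -[1+_] k∈
    ... | _ , _ , refl = ℤ.-<+

    negative-position∈negatives : ∀ {t} → t < n → a t <ℤ + 0 → a t ∈ negatives
    negative-position∈negatives {t} t<n at<0 =
      applyUpTo⁺ -[1+_] (position-negative P at<0) (ℕP.≤-<-trans (ℕP.m∸n≤m t (nth P t)) t<n)

    inner-negatives⊆negatives : ∀ {k} → k ∈ inner-negatives → k ∈ negatives
    inner-negatives⊆negatives k∈ with applyUpTo⁻ (λ i → a (suc e + i)) k∈
    ... | i , i<n-d , refl = negative-position∈negatives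
      (subst (suc e + i <_) (ℕP.m+[n∸m]≡n e<length) (ℕP.+-monoʳ-< (suc e) i<n-d))
      (a<0 (s≤s (ℕP.m≤m+n e i)))

    ∈inner-negatives⇒S : ∀ {k} → k ∈ inner-negatives → S k
    ∈inner-negatives⇒S k∈ with applyUpTo⁻ (λ i → a (suc e + i)) k∈
    ... | i , _ , refl = Maya-position μ (suc e + i)

    ¬S⇒∈negatives : ∀ {k} → k <ℤ + 0 → ¬ S k → k ∈ negatives
    ¬S⇒∈negatives {+ _} (ℤ.+<+ ()) _
    ¬S⇒∈negatives { -[1+ i ]} _ ¬Sk with i ℕP.<? n
    ... | yes i<n = applyUpTo⁺ -[1+_] refl i<n
    ... | no  i≮n = ⊥-elim (¬Sk (subst S (position-beyond P (ℕP.≮⇒≥ i≮n)) (Maya-position μ i)))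

    S∩negatives⊆inner-negatives : ∀ {k} → k ∈ negatives → S k → k ∈ inner-negatives
    S∩negatives⊆inner-negatives k∈ Sk with Maya⇒position μ Sk | applyUpTo⁻ -[1+_] k∈
    ... | t , refl | i , i<n , at≡-[1+i] =
      applyUpTo⁺ (λ i → a (suc e + i)) (cong a (sym (ℕP.m+[n∸m]≡n e<t))) (ℕP.∸-monoˡ-< t<n e<t)
      where
      e<t : e < t
      e<t = ℕP.≰⇒> (λ t≤e → ℤP.<⇒≱ (∈negatives⇒<0 k∈) (from (0≤a⇔ t) t≤e))
      t<n : t < n
      t<n = ℕP.≰⇒> (λ n≤t → ℕP.<⇒≢ (ℕP.<-≤-trans i<n n≤t)
              (ℤP.-[1+-injective (trans (sym at≡-[1+i]) (position-beyond P n≤t))))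

    L⁺⇔ : ∀ k → k ∈ L⁺ ⇔ (S′ k × + 0 ≤ℤ k)
    L⁺⇔ k = mk⇔ into onto
      where
      into : k ∈ L⁺ → S′ k × + 0 ≤ℤ k
      into k∈ with applyUpTo⁻ a k∈
      ... | j , j<e , refl = (Maya-position μ j , ℕP.<⇒≢ j<e ∘ decreasing-injective a↓) ,
                             from (0≤a⇔ j) (ℕP.<⇒≤ j<e)
      onto : S′ k × + 0 ≤ℤ k → k ∈ L⁺
      onto ((Sk , k≢ae) , 0≤k) with Maya⇒position μ Sk
      ... | j , refl = applyUpTo⁺ a refl (ℕP.≤∧≢⇒< (to (0≤a⇔ j) 0≤k) (k≢ae ∘ cong a))

    L⁻⇔ : ∀ k → k ∈ L⁻ ⇔ ((¬ S′ k) × k <ℤ + 0)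
    L⁻⇔ k = mk⇔ into onto
      where
      into : k ∈ L⁻ → (¬ S′ k) × k <ℤ + 0
      into k∈ with ∈-filter⁻ (λ k → ¬? (k ∈? inner-negatives)) {xs = negatives} k∈
      ... | k∈neg , k∉inner = k∉inner ∘ S∩negatives⊆inner-negatives k∈neg ∘ proj₁ , ∈negatives⇒<0 k∈neg
      onto : (¬ S′ k) × k <ℤ + 0 → k ∈ L⁻
      onto (¬S′k , k<0) = ∈-filter⁺ (λ k → ¬? (k ∈? inner-negatives))
        (¬S⇒∈negatives k<0 (¬S′k ∘ S⇒S′ k<0)) (¬S′k ∘ S⇒S′ k<0 ∘ ∈inner-negatives⇒S)

    |L⁻|≡d : length L⁻ ≡ suc e
    |L⁻|≡d = ℕP.+-cancelʳ-≡ (n ∸ suc e) (length L⁻) (suc e) (begin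
      length L⁻ + (n ∸ suc e)             ≡⟨ cong (λ m → length L⁻ + m) (sym (length-applyUpTo _ (n ∸ suc e))) ⟩
      length L⁻ + length inner-negatives  ≡⟨ length-filter-∉ ℤ._≟_ negatives! inner-negatives! inner-negatives⊆negatives ⟩
      length negatives                    ≡⟨ length-applyUpTo -[1+_] n ⟩
      n                                   ≡⟨ sym (ℕP.m+[n∸m]≡n e<length) ⟩
      suc e + (n ∸ suc e)                 ∎)
      where open Relation.Binary.PropositionalEquality.≡-Reasoning

  S′-charge : IsCharge S′ -[1+ 0 ]
  S′-charge = L⁺ , L⁻ , Unique.applyUpTo⁺₁ a e (λ i<j _ → ℕP.<⇒≢ i<j ∘ decreasing-injective a↓) ,
    Unique.filter⁺ _ negatives! ,
    L⁺⇔ , L⁻⇔ , charge≡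
    where
    -1≡x-[1+x] : ∀ x → ℤ.- + 1 ≡ x - (+ 1 +ℤ x)
    -1≡x-[1+x] = solve-∀
    charge≡ : -[1+ 0 ] ≡ + length L⁺ - + length L⁻
    charge≡ rewrite length-applyUpTo a e | |L⁻|≡d = -1≡x-[1+x] (+ e)

  Maya-μʳ : Maya μʳ ≈ₛ shift S′ -[1+ 0 ]
  Maya-μʳ = from (Maya≈shift⇔enumerates μʳ S′ -[1+ 0 ]) μʳ-enumerates

  μʳ-IsMuR : IsMuR μ μʳ
  μʳ-IsMuR = a e , min-S⁺ , -[1+ 0 ] , S′-charge , Maya-μʳ

  -- The charge of S(μ) \ {min S(μ)⁺} is never consulted: the shift is determined by the Maya diagrams.
  IsMuR⇒nth≡ : ∀ ν → IsMuR μ ν → ∀ j → nth (parts ν) j ≡ nth (parts μʳ) j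
  IsMuR⇒nth≡ ν (m , m-min , c , _ , Maya-ν) = Maya≈shift-injective ν μʳ {S′}
    (subst (λ m → Maya ν ≈ₛ shift (remove S m) c) (IsMinPos-unique m-min min-S⁺) Maya-ν)
    Maya-μʳ

lemma5p9 : (μ : Partition) → Nonempty μ → (d : ℕ) → IsDiag μ d →
    Σ Partition (λ ν → IsMuR μ ν) ×
    ((ν : Partition) → IsMuR μ ν → (i : ℕ) → 1 ≤ i →
      (i < d → ν ‼ i ≡ (μ ‼ i) + 1) × (d ≤ i → ν ‼ i ≡ μ ‼ suc i))
lemma5p9 μ _ zero    (() , _)
lemma5p9 μ _ (suc e) diag = (μʳ , μʳ-IsMuR) , parts-of-μʳ
  where
  open Diagonal μ e diag
  parts-of-μʳ : (ν : Partition) → IsMuR μ ν → (i : ℕ) → 1 ≤ i →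
    (i < suc e → ν ‼ i ≡ (μ ‼ i) + 1) × (suc e ≤ i → ν ‼ i ≡ μ ‼ suc i)
  parts-of-μʳ ν ν-IsMuR (suc j) _ =
    (λ { (s≤s j<e) → trans (IsMuR⇒nth≡ ν ν-IsMuR j)
                      (trans (nth-dropAndBump-< e (parts μ) e<length j<e) (ℕP.+-comm 1 (μ ‼ suc j))) }) ,
    (λ { (s≤s e≤j) → trans (IsMuR⇒nth≡ ν ν-IsMuR j) (nth-dropAndBump-≥ e (parts μ) e≤j) })
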